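{- Let $p$ be a prime number and $n \geq 1$ an integer. Then the set of all solutions $(x,y,z)$ in non-negative integers of the Diophantine equation $$p^x + p^y = z^{2n}$$ is exactly the following. For $n = 1$: - if $p = 2$: the triples $(2s+3,\, 2s,\, 3\cdot 2^s)$, $(2s,\, 2s+3,\, 3\cdot 2^s)$ and $(2s+1,\, 2s+1,\, 2^{s+1})$, where $s$ ranges over all non-negative integers; - if $p = 3$: the triples $(2s+1,\, 2s,\, 2\cdot 3^s)$ and $(2s,\, 2s+1,\, 2\cdot 3^s)$, where $s$ ranges over all non-negative integers; - if $p > 3$: there are no solutions. For $n > 1$: - if $p = 2$: the triples $(2s+1,\, 2s+1,\, 2^{(s+1)/n})$, where $s$ ranges over all non-negative integers with $s+1 \equiv 0 \pmod n$; - if $p \geq 3$: there are no solutions. -}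

module Defs where

open import Data.Nat using (ℕ; _+_; _*_; _^_; _>_)
open import Data.Product using (∃-syntax; _×_)
open import Data.Sum using (_⊎_)
open import Data.Empty using (⊥)
open import Relation.Binary.PropositionalEquality using (_≡_)

IsSolution : ℕ → ℕ → ℕ → ℕ → ℕ → Set
IsSolution p n x y z = p ^ x + p ^ y ≡ z ^ (2 * n)

Family-n1-p2 : ℕ → ℕ → ℕ → Set
Family-n1-p2 x y z =
  ∃[ s ] ((x ≡ 2 * s + 3 × y ≡ 2 * s × z ≡ 3 * 2 ^ s)
        ⊎ (x ≡ 2 * s × y ≡ 2 * s + 3 × z ≡ 3 * 2 ^ s)
        ⊎ (x ≡ 2 * s + 1 × y ≡ 2 * s + 1 × z ≡ 2 ^ (s + 1)))

Family-n1-p3 : ℕ → ℕ → ℕ → Set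
Family-n1-p3 x y z =
  ∃[ s ] ((x ≡ 2 * s + 1 × y ≡ 2 * s × z ≡ 2 * 3 ^ s)
        ⊎ (x ≡ 2 * s × y ≡ 2 * s + 1 × z ≡ 2 * 3 ^ s))

-- n > 1, p = 2 : s + 1 ≡ 0 (mod n), written s + 1 = k * n, and z = 2^k = 2^((s+1)/n)
Family-n>1-p2 : ℕ → ℕ → ℕ → ℕ → Set
Family-n>1-p2 n x y z =
  ∃[ s ] ∃[ k ] (s + 1 ≡ k * n × x ≡ 2 * s + 1 × y ≡ 2 * s + 1 × z ≡ 2 ^ k)

module Submission where

-- Write the smaller exponent first. If x = y the equation is p^x · 2 = z^(2n); if y = x + d
-- with d ≥ 1 it is p^x · (1 + p^d) = z^(2n), where p ∤ 1 + p^d. The main tool is the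
-- p-factorisation w = p^e · w' (p ∤ w'), which exists and is unique; comparing factorisations
-- shows that if p^x · u is a k-th power with p ∤ u then k ∣ x and u is itself a k-th power.
--   * x = y: for p ≠ 2 this would make 2 a proper power; for p = 2 it gives z = 2^e, x + 1 = 2ne.
--   * x < y: 1 + p^d = m^2 with m = c^n, so (m-1)(m+1) = p^d and m ∓ 1 are powers of p two
--     apart: only 1, 3 (p = 3) and 2, 4 (p = 2). Then c^n ∈ {2, 3} forces n = 1.
-- The file develops facts on primes and powers, the p-factorisation, the equation
-- 1 + p^d = m^2, and the classification of all solutions into three Shapes (together with the
-- converse check).

open import Defs
open import Data.Nat using (ℕ; _≥_; _>_)
open import Data.Nat.Primality using (Prime)
open import Data.Empty using (⊥)
open import Data.Product using (_×_)
open import Relation.Binary.PropositionalEquality using (_≡_)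
open import Function.Bundles using (_⇔_; mk⇔; module Equivalence)

open import Data.Nat using (zero; suc; _+_; _*_; _^_; _≤_; _<_; z≤n; s≤s; _≟_; _≤?_; ≢-nonZero; ≢-nonZero⁻¹)
open import Data.Nat.Properties
open import Data.Nat.Divisibility
  using (_∣_; _∤_; _∣?_; quotient; quotient≢0; quotient-<; m∣n⇒n≡m*quotient; ∣1⇒≡1; m∣m*n; ∣m⇒∣m*n; ∣m+n∣m⇒∣n; _∣0)
open import Data.Nat.Primality
  using (prime?; prime⇒irreducible; prime⇒nonTrivial; prime⇒nonZero; ¬prime[0]; ¬prime[1]; prime[2]; euclidsLemma)
open import Data.Nat.Induction using (<-rec)
open import Data.Nat.Tactic.RingSolver using (solve-∀)
open import Data.Product using (∃-syntax; _,_)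
open import Data.Sum using (_⊎_; inj₁; inj₂)
open import Function using (_∘_)
open import Function.Construct.Symmetry using (⇔-sym)
open import Function.Construct.Composition using (_⇔-∘_)
open import Relation.Binary.Definitions using (tri<; tri≈; tri>)
open import Relation.Binary.PropositionalEquality using (_≢_; refl; sym; trans; cong; cong₂; subst; module ≡-Reasoning)
open import Relation.Nullary using (yes; no; contradiction)
open import Relation.Nullary.Decidable using (from-yes)

variable
  p n x y z a b c d k m u v w : ℕ

prime∤1 : Prime p → p ∤ 1
prime∤1 pp p∣1 = ¬prime[1] (subst Prime (∣1⇒≡1 p∣1) pp)

prime[3] : Prime 3
prime[3] = from-yes (prime? 3)

prime∣prime⇒≡ : ∀ {q} → Prime p → Prime q → p ∣ q → p ≡ q
prime∣prime⇒≡ pp pq p∣q with prime⇒irreducible pq p∣q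
... | inj₁ refl = contradiction pp ¬prime[1]
... | inj₂ p≡q = p≡q

prime∤* : Prime p → p ∤ a → p ∤ b → p ∤ a * b
prime∤* {a = a} {b} pp p∤a p∤b p∣ab with euclidsLemma a b pp p∣ab
... | inj₁ p∣a = p∤a p∣a
... | inj₂ p∣b = p∤b p∣b

prime∤^ : Prime p → p ∤ a → ∀ k → p ∤ a ^ k
prime∤^ pp p∤a zero = prime∤1 pp
prime∤^ pp p∤a (suc k) = prime∤* pp p∤a (prime∤^ pp p∤a k)

prime^≢0 : Prime p → ∀ k → p ^ k ≢ 0
prime^≢0 {p} pp k p^k≡0 = ¬prime[0] (subst Prime (m^n≡0⇒m≡0 p k p^k≡0) pp)

^-distribʳ-* : ∀ a b k → (a * b) ^ k ≡ a ^ k * b ^ k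
^-distribʳ-* a b zero = refl
^-distribʳ-* a b (suc k) = trans (cong (a * b *_) (^-distribʳ-* a b k)) ([m*n]*[o*p]≡[m*o]*[n*p] a b (a ^ k) (b ^ k))

^-injectiveʳ : ∀ a → 1 < a → a ^ m ≡ a ^ n → m ≡ n
^-injectiveʳ {m} {n} a 1<a eq with <-cmp m n
... | tri< m<n _ _ = contradiction eq (<⇒≢ (^-monoʳ-< a 1<a m<n))
... | tri≈ _ m≡n _ = m≡n
... | tri> _ _ n<m = contradiction (sym eq) (<⇒≢ (^-monoʳ-< a 1<a n<m))

proper-power-gap : ∀ a k → 2 ≤ k → a ^ k ≤ 1 ⊎ 4 ≤ a ^ k
proper-power-gap zero (suc k) _ = inj₁ z≤n
proper-power-gap (suc zero) k _ = inj₁ (≤-reflexive (^-zeroˡ k))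
proper-power-gap a@(suc (suc _)) k 2≤k =
  inj₂ (≤-trans (^-monoˡ-≤ 2 {2} {a} (s≤s (s≤s z≤n))) (^-monoʳ-≤ a 2≤k))

small-power : 0 < k → a ^ k ≡ c → 2 ≤ c → c ≤ 3 → k ≡ 1 × a ≡ c
small-power {k} {a} {c} 0<k a^k≡c 2≤c c≤3 with 2 ≤? k
... | yes 2≤k with proper-power-gap a k 2≤k
...   | inj₁ a^k≤1 = contradiction (≤-trans 2≤c (subst (_≤ 1) a^k≡c a^k≤1)) λ { (s≤s ()) }
...   | inj₂ 4≤a^k = contradiction (≤-trans (subst (4 ≤_) a^k≡c 4≤a^k) c≤3) λ { (s≤s (s≤s (s≤s ()))) }
small-power {k} {a} 0<k a^k≡c _ _ | no 2≰k with ≤-antisym (≤-pred (≰⇒> 2≰k)) 0<k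
... | refl = refl , trans (sym (^-identityʳ a)) a^k≡c

record PFactorisation (p w : ℕ) : Set where
  constructor factorisation
  field
    exponent   : ℕ
    cofactor   : ℕ
    factorises : w ≡ p ^ exponent * cofactor
    p∤cofactor : p ∤ cofactor

p-factorise : Prime p → ∀ w → w ≢ 0 → PFactorisation p w
p-factorise {p} pp = <-rec (λ w → w ≢ 0 → PFactorisation p w) split
  where
  instance _ = prime⇒nonTrivial pp
  split : ∀ w → (∀ {v} → v < w → v ≢ 0 → PFactorisation p v) → w ≢ 0 → PFactorisation p w
  split w smaller w≢0 with p ∣? w
  ... | no p∤w = factorisation 0 w (sym (*-identityˡ w)) p∤w
  ... | yes p∣w =
    let instance _ = ≢-nonZero w≢0
        q = quotient p∣w
        factorisation e c q≡ p∤c = smaller (quotient-< p∣w) (≢-nonZero⁻¹ q {{quotient≢0 p∣w}})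
        open ≡-Reasoning
    in factorisation (suc e) c (begin
         w             ≡⟨ m∣n⇒n≡m*quotient p∣w ⟩
         p * q         ≡⟨ cong (p *_) q≡ ⟩
         p * (p ^ e * c) ≡⟨ *-assoc p (p ^ e) c ⟨
         p ^ suc e * c ∎) p∤c

p-factorisation-unique : Prime p → ∀ a b → p ∤ u → p ∤ v → p ^ a * u ≡ p ^ b * v → a ≡ b × u ≡ v
p-factorisation-unique {u = u} {v} pp zero zero _ _ eq = refl , trans (sym (*-identityˡ u)) (trans eq (*-identityˡ v))
p-factorisation-unique {p} {u} {v} pp zero (suc b) p∤u _ eq =
  contradiction (subst (p ∣_) (trans (sym eq) (*-identityˡ u)) (∣m⇒∣m*n v (m∣m*n (p ^ b)))) p∤u
p-factorisation-unique {p} {u} {v} pp (suc a) zero _ p∤v eq =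
  contradiction (subst (p ∣_) (trans eq (*-identityˡ v)) (∣m⇒∣m*n u (m∣m*n (p ^ a)))) p∤v
p-factorisation-unique {p} {u} {v} pp (suc a) (suc b) p∤u p∤v eq
  with p-factorisation-unique pp a b p∤u p∤v
         (*-cancelˡ-≡ _ _ p {{prime⇒nonZero pp}} (trans (sym (*-assoc p (p ^ a) u)) (trans eq (*-assoc p (p ^ b) v))))
... | a≡b , u≡v = cong suc a≡b , u≡v

-- If p^x · u is a k-th power (k ≥ 1) and p ∤ u, then comparing p-factorisations
-- shows x = k·e, z = p^e · c and u = c^k.
kth-power-split : Prime p → 0 < k → p ∤ u → p ^ x * u ≡ z ^ k →
  ∃[ e ] ∃[ c ] (z ≡ p ^ e * c × x ≡ k * e × u ≡ c ^ k)
kth-power-split {p} {k} {u} {x} {z} pp 0<k p∤u eq =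
  let factorisation e c z≡ p∤c = p-factorise pp z z≢0
      open ≡-Reasoning
      eq′ : p ^ x * u ≡ p ^ (k * e) * c ^ k
      eq′ = begin
        p ^ x * u          ≡⟨ eq ⟩
        z ^ k              ≡⟨ cong (_^ k) z≡ ⟩
        (p ^ e * c) ^ k    ≡⟨ ^-distribʳ-* (p ^ e) c k ⟩
        (p ^ e) ^ k * c ^ k ≡⟨ cong (_* c ^ k) (^-*-assoc p e k) ⟩
        p ^ (e * k) * c ^ k ≡⟨ cong (λ i → p ^ i * c ^ k) (*-comm e k) ⟩
        p ^ (k * e) * c ^ k ∎
      x≡ , u≡ = p-factorisation-unique pp x (k * e) p∤u (prime∤^ pp p∤c k) eq′
  in e , c , z≡ , x≡ , u≡
  where
  0^k≡0 : 0 < k → 0 ^ k ≡ 0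
  0^k≡0 (s≤s _) = refl
  z≢0 : z ≢ 0
  z≢0 refl with m*n≡0⇒m≡0∨n≡0 (p ^ x) (trans eq (0^k≡0 0<k))
  ... | inj₁ p^x≡0 = prime^≢0 pp x p^x≡0
  ... | inj₂ refl = p∤u (p ∣0)

-- A factor of a prime power is itself a power of p: its cofactor divides 1.
factor-of-prime-power : Prime p → a * b ≡ p ^ d → ∃[ i ] a ≡ p ^ i
factor-of-prime-power {p} {a} {b} {d} pp ab≡ =
  let factorisation i a′ a≡ p∤a′ = p-factorise pp a λ { refl → prime^≢0 pp d (sym ab≡) }
      factorisation j b′ b≡ p∤b′ = p-factorise pp b λ { refl → prime^≢0 pp d (trans (sym ab≡) (*-zeroʳ a)) }
      open ≡-Reasoning
      eq : p ^ (i + j) * (a′ * b′) ≡ p ^ d * 1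
      eq = begin
        p ^ (i + j) * (a′ * b′)     ≡⟨ cong (_* (a′ * b′)) (^-distribˡ-+-* p i j) ⟩
        p ^ i * p ^ j * (a′ * b′)   ≡⟨ [m*n]*[o*p]≡[m*o]*[n*p] (p ^ i) (p ^ j) a′ b′ ⟩
        (p ^ i * a′) * (p ^ j * b′) ≡⟨ cong₂ _*_ a≡ b≡ ⟨
        a * b                       ≡⟨ ab≡ ⟩
        p ^ d                       ≡⟨ *-identityʳ (p ^ d) ⟨
        p ^ d * 1                   ∎
      _ , a′b′≡1 = p-factorisation-unique pp (i + j) d (prime∤* pp p∤a′ p∤b′) (prime∤1 pp) eq
  in i , trans a≡ (trans (cong (p ^ i *_) (m*n≡1⇒m≡1 a′ b′ a′b′≡1)) (*-identityʳ (p ^ i)))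

-- Two powers of 2 differing by 1 are 1 and 2: for a, b ≥ 1 the left side is odd, the right even.
powers-of-two-one-apart : ∀ a b → 2 ^ a + 1 ≡ 2 ^ b → a ≡ 0 × b ≡ 1
powers-of-two-one-apart a zero eq =
  contradiction (subst (2 ≤_) eq (+-monoˡ-≤ 1 (m^n>0 2 a))) λ { (s≤s ()) }
powers-of-two-one-apart zero b eq = refl , ^-injectiveʳ 2 ≤-refl (sym eq)
powers-of-two-one-apart (suc a) (suc b) eq =
  contradiction (∣m+n∣m⇒∣n (subst (2 ∣_) (sym eq) (m∣m*n (2 ^ b))) (m∣m*n (2 ^ a))) (prime∤1 prime[2])

prime-powers-two-apart : Prime p → ∀ i j → p ^ i + 2 ≡ p ^ j →
  (p ≡ 2 × i ≡ 1 × j ≡ 2) ⊎ (p ≡ 3 × i ≡ 0 × j ≡ 1)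
prime-powers-two-apart {p} pp i zero eq =
  contradiction (subst (2 ≤_) eq (m≤n+m 2 (p ^ i))) λ { (s≤s ()) }
prime-powers-two-apart {p} pp zero (suc j) eq with prime∣prime⇒≡ pp prime[3] (subst (p ∣_) (sym eq) (m∣m*n (p ^ j)))
... | refl = inj₂ (refl , refl , ^-injectiveʳ 3 (s≤s (s≤s z≤n)) (sym eq))
prime-powers-two-apart {p} pp (suc i) (suc j) eq
  with prime∣prime⇒≡ pp prime[2] (∣m+n∣m⇒∣n (subst (p ∣_) (sym eq) (m∣m*n (p ^ j))) (m∣m*n (p ^ i)))
... | refl with powers-of-two-one-apart i j (*-cancelˡ-≡ _ _ 2 (trans (*-distribˡ-+ 2 (2 ^ i) 1) eq))
...   | refl , refl = inj₁ (refl , refl , refl)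

square-minus-one : ∀ t → 1 + w ≡ (2 + t) * (2 + t) → (1 + t) * (3 + t) ≡ w
square-minus-one t eq = suc-injective (trans (square-identity t) (sym eq))
  where
  square-identity : ∀ t → 1 + (1 + t) * (3 + t) ≡ (2 + t) * (2 + t)
  square-identity = solve-∀

-- 1 + p^d is a perfect square only as 1 + 2^3 = 3^2 or 1 + 3^1 = 2^2: writing m = t + 2,
-- (t+1)(t+3) = p^d, so t+1 and t+3 are powers of p two apart.
square-above-prime-power : Prime p → 1 + p ^ d ≡ m * m →
  (p ≡ 2 × d ≡ 3 × m ≡ 3) ⊎ (p ≡ 3 × d ≡ 1 × m ≡ 2)
square-above-prime-power {m = zero} pp ()
square-above-prime-power {p} {d} {m = suc zero} pp eq = contradiction (suc-injective eq) (prime^≢0 pp d)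
square-above-prime-power {p} {d} {m = suc (suc t)} pp eq
  with product ← square-minus-one t eq
  with i , t+1≡ ← factor-of-prime-power {b = 3 + t} {d} pp product
     | j , t+3≡ ← factor-of-prime-power {b = 1 + t} {d} pp (trans (*-comm (3 + t) (1 + t)) product)
  with prime-powers-two-apart pp i j (trans (cong (_+ 2) (sym t+1≡)) (trans (+-comm (1 + t) 2) t+3≡))
... | inj₁ (refl , refl , refl) with refl ← suc-injective t+1≡ =
  inj₁ (refl , ^-injectiveʳ 2 ≤-refl (sym product) , refl)
... | inj₂ (refl , refl , refl) with refl ← t+1≡ =
  inj₂ (refl , ^-injectiveʳ 3 (s≤s (s≤s z≤n)) (sym product) , refl)

odd-predecessor : ∀ x m → suc x ≡ 2 * m → ∃[ s ] (s + 1 ≡ m × x ≡ 2 * s + 1)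
odd-predecessor x zero ()
odd-predecessor x (suc s) eq = s , +-comm s 1 , suc-injective (trans eq (double-suc s))
  where
  double-suc : ∀ s → 2 * suc s ≡ suc (2 * s + 1)
  double-suc = solve-∀

2*n*e≡2*[e*n] : ∀ n e → 2 * n * e ≡ 2 * (e * n)
2*n*e≡2*[e*n] = solve-∀

square-power : ∀ c n → c ^ (2 * n) ≡ c ^ n * c ^ n
square-power c n = trans (cong (c ^_) (cong (n +_) (+-identityʳ n))) (^-distribˡ-+-* c n n)

factor-out-smaller : ∀ p x d → p ^ x * (1 + p ^ suc d) ≡ p ^ x + p ^ suc (x + d)
factor-out-smaller p x d = begin
  p ^ x * (1 + p ^ suc d)           ≡⟨ *-distribˡ-+ (p ^ x) 1 (p ^ suc d) ⟩
  p ^ x * 1 + p ^ x * p ^ suc d     ≡⟨ cong₂ _+_ (*-identityʳ (p ^ x)) (sym (^-distribˡ-+-* p x (suc d))) ⟩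
  p ^ x + p ^ (x + suc d)           ≡⟨ cong (λ i → p ^ x + p ^ i) (+-suc x d) ⟩
  p ^ x + p ^ suc (x + d)           ∎
  where open ≡-Reasoning

prime∤1+p^ : Prime p → ∀ d → p ∤ 1 + p ^ suc d
prime∤1+p^ {p} pp d p∣ = prime∤1 pp (∣m+n∣m⇒∣n (subst (p ∣_) (+-comm 1 (p ^ suc d)) p∣) (m∣m*n (p ^ d)))

UnorderedPair : ℕ → ℕ → ℕ → ℕ → Set
UnorderedPair x y a b = (x ≡ a × y ≡ b) ⊎ (x ≡ b × y ≡ a)

swap-pair : UnorderedPair x y a b → UnorderedPair y x a b
swap-pair (inj₁ (x≡a , y≡b)) = inj₂ (y≡b , x≡a)
swap-pair (inj₂ (x≡b , y≡a)) = inj₁ (y≡a , x≡b)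

data Shape (p n x y z : ℕ) : Set where
  equal-exponents   : p ≡ 2 → Family-n>1-p2 n x y z → Shape p n x y z
  exponents-3-apart : p ≡ 2 → n ≡ 1 → (s : ℕ) → UnorderedPair x y (2 * s + 3) (2 * s) →
                      z ≡ 3 * 2 ^ s → Shape p n x y z
  exponents-1-apart : p ≡ 3 → n ≡ 1 → (s : ℕ) → UnorderedPair x y (2 * s + 1) (2 * s) →
                      z ≡ 2 * 3 ^ s → Shape p n x y z

swap-shape : Shape p n x y z → Shape p n y x z
swap-shape (equal-exponents p≡2 (s , k , s+1≡ , x≡ , y≡ , z≡)) = equal-exponents p≡2 (s , k , s+1≡ , y≡ , x≡ , z≡)
swap-shape (exponents-3-apart p≡2 n≡1 s xy z≡) = exponents-3-apart p≡2 n≡1 s (swap-pair xy) z≡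
swap-shape (exponents-1-apart p≡3 n≡1 s xy z≡) = exponents-1-apart p≡3 n≡1 s (swap-pair xy) z≡

2≤2*n : 0 < n → 2 ≤ 2 * n
2≤2*n 0<n = *-monoʳ-≤ 2 0<n

0<2*n : 0 < n → 0 < 2 * n
0<2*n 0<n = ≤-trans (s≤s z≤n) (2≤2*n 0<n)

twice : ∀ m → m * 2 ≡ m + m
twice m = trans (*-comm m 2) (cong (m +_) (+-identityʳ m))

doubling : ∀ x → 2 ^ x + 2 ^ x ≡ 2 ^ suc x
doubling x = cong (2 ^ x +_) (sym (+-identityʳ (2 ^ x)))

power-of-two-root : 0 < n → 2 ^ suc x ≡ z ^ (2 * n) → Family-n>1-p2 n x x z
power-of-two-root {n} {x} 0<n eq
  with e , c , z≡ , x+1≡ , 1≡c^2n ←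
         kth-power-split prime[2] (0<2*n 0<n) (prime∤1 prime[2]) (trans (*-identityʳ (2 ^ suc x)) eq)
  with m^n≡1⇒n≡0∨m≡1 c (2 * n) (sym 1≡c^2n)
... | inj₁ 2n≡0 = contradiction 2n≡0 (m<n⇒n≢0 (0<2*n 0<n))
... | inj₂ refl with s , s+1≡ , x≡ ← odd-predecessor x (e * n) (trans x+1≡ (2*n*e≡2*[e*n] n e)) =
  s , e , s+1≡ , x≡ , x≡ , trans z≡ (*-identityʳ (2 ^ e))

-- For p ≠ 2, p^x · 2 = z^(2n) would make 2 = c^(2n) a proper power.
twice-prime-power-not-square : Prime p → p ≢ 2 → 0 < n → p ^ x * 2 ≢ z ^ (2 * n)
twice-prime-power-not-square {x = x} pp p≢2 0<n eq
  with e , c , _ , _ , 2≡c^2n ← kth-power-split {x = x} pp (0<2*n 0<n) (p≢2 ∘ prime∣prime⇒≡ pp prime[2]) eq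
  with 2n≡1 , _ ← small-power (0<2*n 0<n) (sym 2≡c^2n) ≤-refl (s≤s (s≤s z≤n)) =
  contradiction (subst (2 ≤_) 2n≡1 (2≤2*n 0<n)) λ { (s≤s ()) }

-- x = y: the equation reads p^x · 2 = z^(2n), so p = 2 and (x, x, z) has equal exponents.
classify-equal : Prime p → 0 < n → IsSolution p n x x z → Shape p n x x z
classify-equal {p} {x = x} pp 0<n sol with p ≟ 2
... | yes refl = equal-exponents refl (power-of-two-root {x = x} 0<n (trans (sym (doubling x)) sol))
... | no p≢2 = contradiction (trans (twice (p ^ x)) sol) (twice-prime-power-not-square {x = x} pp p≢2 0<n)

-- x < y, say y = x + d with d ≥ 1: then p^x · (1 + p^d) = z^(2n) with p ∤ 1 + p^d, so x = 2ne,
-- z = p^e c and 1 + p^d = (c^n)^2; the square lemma pins down p, d and c^n ∈ {2, 3}, whence n = 1.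
classify-distinct : Prime p → 0 < n → x < y → IsSolution p n x y z → Shape p n x y z
classify-distinct {p} {n} {x} {z = z} pp 0<n x<y sol
  with d , refl ← m≤n⇒∃[o]m+o≡n x<y
  with e , c , z≡ , refl , 1+p^d≡c^2n ←
         kth-power-split {x = x} pp (0<2*n 0<n) (prime∤1+p^ pp d) (trans (factor-out-smaller p x d) sol)
  with square-above-prime-power {d = suc d} {c ^ n} pp (trans 1+p^d≡c^2n (square-power c n))
... | inj₁ (refl , refl , c^n≡3) with refl , refl ← small-power 0<n c^n≡3 (s≤s (s≤s z≤n)) ≤-refl =
  exponents-3-apart refl refl e (inj₂ (refl , sym (+-suc (2 * e) 2))) (trans z≡ (*-comm (2 ^ e) 3))
... | inj₂ (refl , refl , c^n≡2) with refl , refl ← small-power 0<n c^n≡2 ≤-refl (s≤s (s≤s z≤n)) =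
  exponents-1-apart refl refl e (inj₂ (refl , sym (+-suc (2 * e) 0))) (trans z≡ (*-comm (3 ^ e) 2))

classify : Prime p → 0 < n → IsSolution p n x y z → Shape p n x y z
classify {p} {x = x} {y} pp 0<n sol with <-cmp x y
... | tri< x<y _ _ = classify-distinct pp 0<n x<y sol
... | tri≈ _ refl _ = classify-equal pp 0<n sol
... | tri> _ _ y<x = swap-shape (classify-distinct pp 0<n y<x (trans (+-comm (p ^ y) (p ^ x)) sol))

scaled-square : ∀ p s d c → p ^ d + 1 ≡ c * c → p ^ (2 * s + d) + p ^ (2 * s) ≡ (c * p ^ s) ^ 2
scaled-square p s d c eq = begin
  p ^ (2 * s + d) + p ^ (2 * s)          ≡⟨ cong (_+ p ^ (2 * s)) (^-distribˡ-+-* p (2 * s) d) ⟩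
  p ^ (2 * s) * p ^ d + p ^ (2 * s)      ≡⟨ cong (λ q → q * p ^ d + q) (square-power p s) ⟩
  p ^ s * p ^ s * p ^ d + p ^ s * p ^ s  ≡⟨ factor (p ^ s) (p ^ d) ⟩
  p ^ s * p ^ s * (p ^ d + 1)            ≡⟨ cong (p ^ s * p ^ s *_) eq ⟩
  p ^ s * p ^ s * (c * c)                ≡⟨ regroup (p ^ s) c ⟩
  (c * p ^ s) ^ 2                        ∎
  where
  open ≡-Reasoning
  factor : ∀ a b → a * a * b + a * a ≡ a * a * (b + 1)
  factor = solve-∀
  regroup : ∀ a c → a * a * (c * c) ≡ c * a * (c * a * 1)
  regroup = solve-∀

doubled-odd-power : ∀ s k n → s + 1 ≡ k * n → 2 ^ (2 * s + 1) + 2 ^ (2 * s + 1) ≡ (2 ^ k) ^ (2 * n)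
doubled-odd-power s k n s+1≡kn = begin
  2 ^ (2 * s + 1) + 2 ^ (2 * s + 1) ≡⟨ doubling (2 * s + 1) ⟩
  2 ^ suc (2 * s + 1)               ≡⟨ cong (2 ^_) (double-successor s) ⟩
  2 ^ (2 * (s + 1))                 ≡⟨ cong (λ m → 2 ^ (2 * m)) s+1≡kn ⟩
  2 ^ (2 * (k * n))                 ≡⟨ cong (2 ^_) (2*n*e≡2*[e*n] n k) ⟨
  2 ^ (2 * n * k)                   ≡⟨ cong (2 ^_) (*-comm (2 * n) k) ⟩
  2 ^ (k * (2 * n))                 ≡⟨ ^-*-assoc 2 k (2 * n) ⟨
  (2 ^ k) ^ (2 * n)                 ∎
  where
  open ≡-Reasoning
  double-successor : ∀ s → suc (2 * s + 1) ≡ 2 * (s + 1)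
  double-successor = solve-∀

pair-sum : UnorderedPair x y a b → p ^ a + p ^ b ≡ w → p ^ x + p ^ y ≡ w
pair-sum (inj₁ (refl , refl)) eq = eq
pair-sum {x = x} {y = y} {p = p} (inj₂ (refl , refl)) eq = trans (+-comm (p ^ x) (p ^ y)) eq

shape-sound : Shape p n x y z → IsSolution p n x y z
shape-sound {n = n} (equal-exponents refl (s , k , s+1≡kn , refl , refl , refl)) = doubled-odd-power s k n s+1≡kn
shape-sound (exponents-3-apart refl refl s xy refl) = pair-sum xy (scaled-square 2 s 3 3 refl)
shape-sound (exponents-1-apart refl refl s xy refl) = pair-sum xy (scaled-square 3 s 1 2 refl)

solutions⇔shapes : Prime p → 0 < n → IsSolution p n x y z ⇔ Shape p n x y z
solutions⇔shapes pp 0<n = mk⇔ (classify pp 0<n) shape-sound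

family-n1-p2⇔shape : Family-n1-p2 x y z ⇔ Shape 2 1 x y z
family-n1-p2⇔shape {x = x} {y} {z} = mk⇔ to from
  where
  to : Family-n1-p2 x y z → Shape 2 1 x y z
  to (s , inj₁ (x≡ , y≡ , z≡))        = exponents-3-apart refl refl s (inj₁ (x≡ , y≡)) z≡
  to (s , inj₂ (inj₁ (x≡ , y≡ , z≡))) = exponents-3-apart refl refl s (inj₂ (x≡ , y≡)) z≡
  to (s , inj₂ (inj₂ (x≡ , y≡ , z≡))) =
    equal-exponents refl (s , s + 1 , sym (*-identityʳ (s + 1)) , x≡ , y≡ , z≡)
  from : Shape 2 1 x y z → Family-n1-p2 x y z
  from (equal-exponents _ (s , k , s+1≡k , x≡ , y≡ , z≡)) =
    s , inj₂ (inj₂ (x≡ , y≡ , trans z≡ (cong (2 ^_) (sym (trans s+1≡k (*-identityʳ k))))))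
  from (exponents-3-apart _ _ s (inj₁ (x≡ , y≡)) z≡) = s , inj₁ (x≡ , y≡ , z≡)
  from (exponents-3-apart _ _ s (inj₂ (x≡ , y≡)) z≡) = s , inj₂ (inj₁ (x≡ , y≡ , z≡))
  from (exponents-1-apart () _ _ _ _)

family-n1-p3⇔shape : Family-n1-p3 x y z ⇔ Shape 3 1 x y z
family-n1-p3⇔shape {x = x} {y} {z} = mk⇔ to from
  where
  to : Family-n1-p3 x y z → Shape 3 1 x y z
  to (s , inj₁ (x≡ , y≡ , z≡)) = exponents-1-apart refl refl s (inj₁ (x≡ , y≡)) z≡
  to (s , inj₂ (x≡ , y≡ , z≡)) = exponents-1-apart refl refl s (inj₂ (x≡ , y≡)) z≡
  from : Shape 3 1 x y z → Family-n1-p3 x y z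
  from (exponents-1-apart _ _ s (inj₁ (x≡ , y≡)) z≡) = s , inj₁ (x≡ , y≡ , z≡)
  from (exponents-1-apart _ _ s (inj₂ (x≡ , y≡)) z≡) = s , inj₂ (x≡ , y≡ , z≡)

family-n>1-p2⇔shape : n ≢ 1 → Family-n>1-p2 n x y z ⇔ Shape 2 n x y z
family-n>1-p2⇔shape {n} {x} {y} {z} n≢1 = mk⇔ (equal-exponents refl) from
  where
  from : Shape 2 n x y z → Family-n>1-p2 n x y z
  from (equal-exponents _ family)       = family
  from (exponents-3-apart _ n≡1 _ _ _) = contradiction n≡1 n≢1
  from (exponents-1-apart () _ _ _ _)

shape-p≤3 : Shape p n x y z → p ≤ 3
shape-p≤3 (equal-exponents refl _)       = s≤s (s≤s z≤n)
shape-p≤3 (exponents-3-apart refl _ _ _ _) = s≤s (s≤s z≤n)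
shape-p≤3 (exponents-1-apart refl _ _ _ _) = ≤-refl

shape-p≡2 : n ≢ 1 → Shape p n x y z → p ≡ 2
shape-p≡2 _ (equal-exponents p≡2 _)           = p≡2
shape-p≡2 n≢1 (exponents-3-apart _ n≡1 _ _ _) = contradiction n≡1 n≢1
shape-p≡2 n≢1 (exponents-1-apart _ n≡1 _ _ _) = contradiction n≡1 n≢1

theorem3p1 : (p n : ℕ) → Prime p → n ≥ 1 → (x y z : ℕ) →
    ((n ≡ 1 → p ≡ 2 → (IsSolution p n x y z ⇔ Family-n1-p2 x y z))
    × (n ≡ 1 → p ≡ 3 → (IsSolution p n x y z ⇔ Family-n1-p3 x y z))
    × (n ≡ 1 → p > 3 → (IsSolution p n x y z → ⊥))
    × (n > 1 → p ≡ 2 → (IsSolution p n x y z ⇔ Family-n>1-p2 n x y z))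
    × (n > 1 → p ≥ 3 → (IsSolution p n x y z → ⊥)))
theorem3p1 p n pp n≥1 x y z =
    (λ { refl refl → ⇔-sym family-n1-p2⇔shape ⇔-∘ solutions })
  , (λ { refl refl → ⇔-sym family-n1-p3⇔shape ⇔-∘ solutions })
  , (λ { refl p>3 → <⇒≱ p>3 ∘ shape-p≤3 ∘ Equivalence.to solutions })
  , (λ { n>1 refl → ⇔-sym (family-n>1-p2⇔shape (>⇒≢ n>1)) ⇔-∘ solutions })
  , (λ n>1 p≥3 sol → <-irrefl (sym (shape-p≡2 (>⇒≢ n>1) (Equivalence.to solutions sol))) p≥3)
  where
  solutions : IsSolution p n x y z ⇔ Shape p n x y z
  solutions = solutions⇔shapes pp n≥1
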